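{- Let $V=\{1,\ldots,n\}$ and let $g_1,\ldots,g_m:2^V\to\mathbb{R}$ be normalized, nonnegative, nondecreasing, subadditive set functions with $g_j(\{i\})>0$ for all $i\in V$, $j\in[m]$. Let $\mathcal{S}^{(0)}=(S_1^{(0)},\ldots,S_m^{(0)})$ be an optimal $m$-partition of the problem of minimizing $\max_{j}\sum_{i\in S_j}g_j(\{i\})$ over all $m$-partitions $(S_1,\ldots,S_m)$ of $V$, and let $\mathcal{S}^*=(S_1^*,\ldots,S_m^*)$ be an optimal $m$-partition of the problem of minimizing $\max_j g_j(S_j)$ over all $m$-partitions of $V$. Then $$\max_j g_j(S_j^{(0)})\le\Big(\max_{j\in[m]}\frac{|S_j^*|}{1+(|S_j^*|-1)(1-\kappa_{g_j}(S_j^*))}\Big)\cdot\max_j g_j(S_j^*).$$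
   Context: An $m$-partition of $V$ is a tuple of pairwise disjoint subsets with union $V$ (some may be empty). $g$ is normalized if $g(\emptyset)=0$, nondecreasing if $g(S)\le g(T)$ whenever $S\subseteq T$, subadditive if $g(S)+g(T)\ge g(S\cup T)$. Write $g(i\mid A)=g(A\cup\{i\})-g(A)$ for $i\notin A$. The curvature of $g$ at $S$ is $\kappa_g(S)=1-\min_{A\subseteq S,\ i\in A}\frac{g(i\mid A\setminus\{i\})}{g(\{i\})}$. -}

module Defs where

open import Level using (Level; _⊔_; suc)
open import Data.Nat as ℕ using (ℕ; zero)
open import Data.Bool using (Bool; true; false; if_then_else_)
open import Data.Fin using (Fin)
open import Data.Fin.Properties using () renaming (_≟_ to _≟ᶠ_)
open import Data.Fin.Subset using (Subset; ⁅_⁆; _∈_; _⊆_; _∪_; _-_; ∣_∣; ⊥)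
open import Data.Fin.Subset.Properties using (_∈?_; _⊆?_)
open import Data.Vec using ([]; _∷_; tabulate)
open import Data.List using (List; []; _∷_; _++_; map; concatMap; foldr; allFin)
open import Data.Product using (_×_)
open import Relation.Nullary using (¬_; yes; no; does)
open import Relation.Binary.Structures using (IsDecTotalOrder)
open import Algebra.Structures using (IsCommutativeRing)

-- Ordered fields (the theorem is stated for an arbitrary ordered field;
-- ℝ is an instance).  Standard axioms: commutative ring, total order,
-- translation invariance, product of nonnegatives is nonnegative,
-- 0 ≠ 1, and multiplicative inverses of nonzero elements.
-- _⁻¹ is total; its value at 0 is unconstrained.

record OrderedField (c ℓ : Level) : Set (suc (c ⊔ ℓ)) where
  infixl 7 _*_
  infixl 6 _+_
  infix  8 -_
  infix  9 _⁻¹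
  infix  4 _≈_ _≤_
  field
    Carrier : Set c
    _≈_     : Carrier → Carrier → Set ℓ
    _≤_     : Carrier → Carrier → Set ℓ
    _+_     : Carrier → Carrier → Carrier
    _*_     : Carrier → Carrier → Carrier
    -_      : Carrier → Carrier
    0#      : Carrier
    1#      : Carrier
    _⁻¹     : Carrier → Carrier
    isCommutativeRing : IsCommutativeRing _≈_ _+_ _*_ -_ 0# 1#
    isDecTotalOrder   : IsDecTotalOrder _≈_ _≤_
    +-mono-≤  : ∀ {x y} z → x ≤ y → x + z ≤ y + z
    *-nonneg  : ∀ {x y} → 0# ≤ x → 0# ≤ y → 0# ≤ x * y
    0≉1       : ¬ (0# ≈ 1#)
    ⁻¹-cong   : ∀ {x y} → x ≈ y → x ⁻¹ ≈ y ⁻¹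
    ⁻¹-inverse : ∀ x → ¬ (x ≈ 0#) → x * x ⁻¹ ≈ 1#

  _<_ : Carrier → Carrier → Set ℓ
  x < y = (x ≤ y) × ¬ (x ≈ y)

  _-ᶠ_ : Carrier → Carrier → Carrier
  x -ᶠ y = x + (- y)

  _/_ : Carrier → Carrier → Carrier
  x / y = x * y ⁻¹

  _≤?_ = IsDecTotalOrder._≤?_ isDecTotalOrder

  max : Carrier → Carrier → Carrier
  max x y = if does (x ≤? y) then y else x

  min : Carrier → Carrier → Carrier
  min x y = if does (x ≤? y) then x else y

  fromℕ : ℕ → Carrier
  fromℕ zero      = 0#
  fromℕ (ℕ.suc k) = 1# + fromℕ k

allSubsets : ∀ n → List (Subset n)
allSubsets zero      = [] ∷ []
allSubsets (ℕ.suc n) = map (true ∷_) (allSubsets n) ++ map (false ∷_) (allSubsets n)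

-- m-partitions of V = Fin n, encoded as assignments σ : Fin n → Fin m
-- (element i lies in block σ i).  Blocks may be empty.

Partition : ℕ → ℕ → Set
Partition n m = Fin n → Fin m

block : ∀ {n m} → Partition n m → Fin m → Subset n
block σ j = tabulate (λ i → does (σ i ≟ᶠ j))

module WithField {c ℓ} (F : OrderedField c ℓ) where
  open OrderedField F

  SetFun : ℕ → Set c
  SetFun n = Subset n → Carrier

  Normalized : ∀ {n} → SetFun n → Set ℓ
  Normalized g = g ⊥ ≈ 0#

  Nonnegative : ∀ {n} → SetFun n → Set ℓ
  Nonnegative g = ∀ S → 0# ≤ g S

  Nondecreasing : ∀ {n} → SetFun n → Set ℓ
  Nondecreasing g = ∀ S T → S ⊆ T → g S ≤ g T

  Subadditive : ∀ {n} → SetFun n → Set ℓ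
  Subadditive g = ∀ S T → g (S ∪ T) ≤ g S + g T

  PositiveSingletons : ∀ {n} → SetFun n → Set ℓ
  PositiveSingletons g = ∀ i → 0# < g ⁅ i ⁆

  maxL : Carrier → List Carrier → Carrier
  maxL d []       = d
  maxL d (x ∷ xs) = foldr max x xs

  minL : Carrier → List Carrier → Carrier
  minL d []       = d
  minL d (x ∷ xs) = foldr min x xs

  sumOver : ∀ {n} → Subset n → (Fin n → Carrier) → Carrier
  sumOver {n} S f = foldr (λ i acc → (if does (i ∈? S) then f i else 0#) + acc) 0# (allFin n)

  marginal : ∀ {n} → SetFun n → Fin n → Subset n → Carrier
  marginal g i A = g (A ∪ ⁅ i ⁆) -ᶠ g A

  curvRatios : ∀ {n} → SetFun n → Subset n → List Carrier
  curvRatios {n} g S =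
    concatMap (λ A → if does (A ⊆? S)
                       then concatMap (λ i → if does (i ∈? A)
                                                then (marginal g i (A - i) / g ⁅ i ⁆) ∷ []
                                                else [])
                                      (allFin n)
                       else [])
              (allSubsets n)

  -- curvature κ_g(S) = 1 − min_{A⊆S, i∈A} g(i | A∖{i}) / g({i})
  -- (only used for nonempty S, where the index set is nonempty)
  curvature : ∀ {n} → SetFun n → Subset n → Carrier
  curvature g S = 1# -ᶠ minL 1# (curvRatios g S)

  -- |S| / (1 + (|S| − 1)(1 − κ_g(S)));  taken to be 0 for S = ∅
  -- (numerator |S| = 0 there).
  approxFactor : ∀ {n} → SetFun n → Subset n → Carrier
  approxFactor g S with ∣ S ∣
  ... | zero    = 0#
  ... | ℕ.suc _ = fromℕ ∣ S ∣ / (1# + (fromℕ ∣ S ∣ -ᶠ 1#) * (1# -ᶠ curvature g S))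

  costMax : ∀ {n m} → (Fin m → SetFun n) → Partition n m → Carrier
  costMax {m = m} g σ = maxL 0# (map (λ j → g j (block σ j)) (allFin m))

  costModular : ∀ {n m} → (Fin m → SetFun n) → Partition n m → Carrier
  costModular {m = m} g σ =
    maxL 0# (map (λ j → sumOver (block σ j) (λ i → g j ⁅ i ⁆)) (allFin m))

  factorMax : ∀ {n m} → (Fin m → SetFun n) → Partition n m → Carrier
  factorMax {m = m} g σ = maxL 0# (map (λ j → approxFactor (g j) (block σ j)) (allFin m))

-- For every block S, subadditivity gives g(S) ≤ Σ_{i∈S} g({i}).  Conversely, with c = 1 − κ_g(S)
-- the marginal gain of any i ∈ A ⊆ S is at least c·g({i}); adding the elements of S ∖ {j} to {j}
-- one at a time gives g({j}) + c·Σ_{i∈S∖{j}} g({i}) ≤ g(S), and averaging over j ∈ S yields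
-- (1 + (|S| − 1)c)·Σ_{i∈S} g({i}) ≤ |S|·g(S).  Hence, the middle step by optimality of S⁰,
--   max_j g_j(S⁰_j) ≤ max_j Σ_{i∈S⁰_j} g_j({i}) ≤ max_j Σ_{i∈S*_j} g_j({i}),
-- and the last maximum is at most max_j |S*_j| / (1 + (|S*_j| − 1)c_j) times max_j g_j(S*_j).

module Submission where

open import Defs
open import Data.Nat using (ℕ; zero; suc; _<_)
open import Data.Nat.Properties using (n≮0)
open import Data.Nat.Induction using (<-wellFounded)
open import Data.Bool using (true; false; if_then_else_)
open import Data.Fin using (Fin; zero; suc)
open import Data.Fin.Properties using () renaming (_≟_ to _≟ᶠ_)
open import Data.Fin.Subset
  using (Subset; inside; outside; ⁅_⁆; _∈_; _∉_; _⊆_; _∪_; _-_; _─_; ∣_∣; ⊥)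
open import Data.Fin.Subset.Properties
  using ( _∈?_; _⊆?_; nonempty?; Empty-unique; x∈p⇒∣p-x∣<∣p∣; p─q⊆p; x∈p∧x≢y⇒x∈p-y
        ; x∈⁅x⁆; x∈⁅y⁆⇒x≡y; x∈p∪q⁻; x∈p∪q⁺; p⊆p∪q; q⊆p∪q; ∪-identityʳ)
open import Data.Vec using ([]; _∷_; here; there)
open import Data.Vec.Properties using (zipWith-identityʳ)
open import Data.List as List using (List; []; _∷_; map; concatMap; foldr; allFin)
open import Data.List.Properties using (foldr-preservesᵇ; foldr-preservesᵒ; foldr-map; map-tabulate)
open import Data.List.Membership.Propositional using (lose) renaming (_∈_ to _∈ˡ_)
open import Data.List.Membership.Propositional.Properties
  using (∈-allFin; ∈-map⁺; ∈-++⁺ˡ; ∈-++⁺ʳ; ∈-concatMap⁺)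
open import Data.List.Relation.Unary.All as All using (All; []; _∷_)
open import Data.List.Relation.Unary.All.Properties using (concat⁺; map⁺)
open import Data.List.Relation.Unary.Any as Any using (Any; here; there)
open import Data.Maybe using (nothing)
open import Data.Product using (_,_; proj₁; proj₂)
open import Data.Sum using (_⊎_; inj₁; inj₂; [_,_]′)
open import Function using (id; _∘_)
open import Induction.WellFounded using (Acc; acc)
open import Relation.Nullary using (¬_; yes; no; does; contradiction)
open import Relation.Nullary.Decidable using (dec-true)
open import Relation.Binary.PropositionalEquality as ≡ using (_≡_; _≢_; refl)
open import Relation.Binary.Bundles using (DecTotalOrder)
open import Algebra.Bundles using (CommutativeRing)
open import Algebra.Construct.NaturalChoice.Base using (MaxOperator; MinOperator)
import Algebra.Construct.NaturalChoice.MaxOp as MaxOp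
import Algebra.Construct.NaturalChoice.MinOp as MinOp
open import Tactic.RingSolver.Core.AlmostCommutativeRing using (fromCommutativeRing)

-- Subsets of Fin n

∪-least : ∀ {n} {p q r : Subset n} → p ⊆ r → q ⊆ r → p ∪ q ⊆ r
∪-least {p = p} {q} p⊆r q⊆r x∈p∪q with x∈p∪q⁻ p q x∈p∪q
... | inj₁ x∈p = p⊆r x∈p
... | inj₂ x∈q = q⊆r x∈q

∪-monoʳ-⊆ : ∀ {n} (p : Subset n) {q r} → q ⊆ r → p ∪ q ⊆ p ∪ r
∪-monoʳ-⊆ p {q} {r} q⊆r = ∪-least (p⊆p∪q r) (q⊆p∪q p r ∘ q⊆r)

x∈p⇒⁅x⁆⊆p : ∀ {n} {x : Fin n} {p} → x ∈ p → ⁅ x ⁆ ⊆ p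
x∈p⇒⁅x⁆⊆p {x = x} {p} x∈p y∈⁅x⁆ = ≡.subst (_∈ p) (≡.sym (x∈⁅y⁆⇒x≡y x y∈⁅x⁆)) x∈p

x∈p─q⇒x∉q : ∀ {n} (p q : Subset n) {x} → x ∈ p ─ q → x ∉ q
x∈p─q⇒x∉q (_ ∷ p) (outside ∷ q) here        ()
x∈p─q⇒x∉q (_ ∷ p) (_       ∷ q) (there x∈) (there x∈q) = x∈p─q⇒x∉q p q x∈ x∈q

x∈p-y⇒x≢y : ∀ {n} (p : Subset n) {x y} → x ∈ p - y → x ≢ y
x∈p-y⇒x≢y p {y = y} x∈p-y refl = x∈p─q⇒x∉q p ⁅ y ⁆ x∈p-y (x∈⁅x⁆ y)

p⊆⁅x⁆∪[p-x] : ∀ {n} (p : Subset n) x → p ⊆ ⁅ x ⁆ ∪ (p - x)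
p⊆⁅x⁆∪[p-x] p x {y} y∈p with y ≟ᶠ x
... | yes refl = x∈p∪q⁺ (inj₁ (x∈⁅x⁆ y))
... | no  y≢x  = x∈p∪q⁺ (inj₂ (x∈p∧x≢y⇒x∈p-y y∈p y≢x))

[p-x]∪⁅x⁆⊆p : ∀ {n} {p : Subset n} {x} → x ∈ p → (p - x) ∪ ⁅ x ⁆ ⊆ p
[p-x]∪⁅x⁆⊆p {p = p} {x} x∈p = ∪-least (p─q⊆p p ⁅ x ⁆) (x∈p⇒⁅x⁆⊆p x∈p)

p∪[q-x]⊆[p∪q]-x : ∀ {n} (p q : Subset n) {x} → x ∉ p → p ∪ (q - x) ⊆ (p ∪ q) - x
p∪[q-x]⊆[p∪q]-x p q {x} x∉p {y} y∈ with x∈p∪q⁻ p (q - x) y∈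
... | inj₁ y∈p   = x∈p∧x≢y⇒x∈p-y (p⊆p∪q q y∈p) (λ { refl → x∉p y∈p })
... | inj₂ y∈q-x = x∈p∧x≢y⇒x∈p-y (q⊆p∪q p q (p─q⊆p q ⁅ x ⁆ y∈q-x)) (x∈p-y⇒x≢y q y∈q-x)

remove-induction : ∀ {a n} (P : Subset n → Set a) → P ⊥ →
                   (∀ T {k} → k ∈ T → P (T - k) → P T) → ∀ T → P T
remove-induction P P⊥ P-step T = go T (<-wellFounded ∣ T ∣)
  where
  go : ∀ T → Acc _<_ ∣ T ∣ → P T
  go T (acc rec) with nonempty? T
  ... | yes (k , k∈T) = P-step T k∈T (go (T - k) (rec (x∈p⇒∣p-x∣<∣p∣ k∈T)))
  ... | no  T-empty   = ≡.subst P (≡.sym (Empty-unique T-empty)) P⊥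

∣p∣≡0⇒p≡⊥ : ∀ {n} {p : Subset n} → ∣ p ∣ ≡ 0 → p ≡ ⊥
∣p∣≡0⇒p≡⊥ {p = p} |p|≡0 = Empty-unique λ (x , x∈p) →
  n≮0 (≡.subst (∣ p - x ∣ <_) |p|≡0 (x∈p⇒∣p-x∣<∣p∣ x∈p))

∈-allSubsets : ∀ {n} (A : Subset n) → A ∈ˡ allSubsets n
∈-allSubsets []            = here refl
∈-allSubsets (inside  ∷ A) = ∈-++⁺ˡ (∈-map⁺ (inside ∷_) (∈-allSubsets A))
∈-allSubsets (outside ∷ A) = ∈-++⁺ʳ _ (∈-map⁺ (outside ∷_) (∈-allSubsets A))

All-map : ∀ {a b p} {A : Set a} {B : Set b} {P : B → Set p} {f : A → B} → (∀ x → P (f x)) →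
          ∀ xs → All P (map f xs)
All-map Pf xs = map⁺ (All.universal Pf xs)

∈-∷⇒⊎Any : ∀ {a p} {A : Set a} {P : A → Set p} {x y ys} → P x → x ∈ˡ y ∷ ys → P y ⊎ Any P ys
∈-∷⇒⊎Any Px (here refl)  = inj₁ Px
∈-∷⇒⊎Any Px (there x∈ys) = inj₂ (Any.map (λ { refl → Px }) x∈ys)

∈-if-true : ∀ {a} {A : Set a} {b} {x : A} {xs} → b ≡ true → x ∈ˡ xs → x ∈ˡ (if b then xs else [])
∈-if-true refl x∈xs = x∈xs

All-if : ∀ {a p} {A : Set a} {P : A → Set p} b {xs} → All P xs → All P (if b then xs else [])
All-if true  Pxs = Pxs
All-if false _   = []

-- Ordered fields

module OrderedFieldProperties {c ℓ} (F : OrderedField c ℓ) where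
  open OrderedField F

  commutativeRing : CommutativeRing c ℓ
  commutativeRing = record { isCommutativeRing = isCommutativeRing }

  decTotalOrder : DecTotalOrder c ℓ ℓ
  decTotalOrder = record { isDecTotalOrder = isDecTotalOrder }

  open CommutativeRing commutativeRing public
    using ( +-cong; +-congˡ; +-congʳ; *-congˡ; *-congʳ; +-comm; *-comm; +-assoc; *-assoc
          ; +-identityˡ; +-identityʳ; *-identityˡ; *-identityʳ; zeroˡ; zeroʳ; distribˡ; distribʳ
          ; -‿cong; -‿inverseˡ; -‿inverseʳ)
    renaming (refl to ≈-refl; sym to ≈-sym; trans to ≈-trans; reflexive to ≈-reflexive)
  open DecTotalOrder decTotalOrder public
    using (total; antisym; poset; totalPreorder)
    renaming (refl to ≤-refl; trans to ≤-trans; reflexive to ≤-reflexive)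
  open import Algebra.Properties.Ring (CommutativeRing.ring commutativeRing)
    using (-1*x≈-x; -‿involutive; -‿distribˡ-*; -‿distribʳ-*)
  open import Algebra.Properties.AbelianGroup (CommutativeRing.+-abelianGroup commutativeRing)
    using (xyx⁻¹≈y; ⁻¹-anti-homo‿-)
  open import Relation.Binary.Reasoning.PartialOrder poset public
  open import Tactic.RingSolver.NonReflective (fromCommutativeRing commutativeRing (λ _ → nothing))
    public using (solve; _⊜_; _⊕_; _⊗_)

  +-monoʳ-≤ : ∀ z {x y} → x ≤ y → z + x ≤ z + y
  +-monoʳ-≤ z {x} {y} x≤y = begin
    z + x  ≈⟨ +-comm z x ⟩
    x + z  ≤⟨ +-mono-≤ z x≤y ⟩
    y + z  ≈⟨ +-comm y z ⟩
    z + y  ∎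

  +-mono₂-≤ : ∀ {x y u v} → x ≤ y → u ≤ v → x + u ≤ y + v
  +-mono₂-≤ {y = y} {u} x≤y u≤v = ≤-trans (+-mono-≤ u x≤y) (+-monoʳ-≤ y u≤v)

  x+y-y≈x : ∀ x y → (x + y) -ᶠ y ≈ x
  x+y-y≈x x y = ≈-trans (+-congʳ (+-comm x y)) (xyx⁻¹≈y y x)

  x-y+y≈x : ∀ x y → x -ᶠ y + y ≈ x
  x-y+y≈x x y = ≈-trans (+-assoc x (- y) y) (≈-trans (+-congˡ (-‿inverseˡ y)) (+-identityʳ x))

  x+[y-x]≈y : ∀ x y → x + (y -ᶠ x) ≈ y
  x+[y-x]≈y x y = ≈-trans (≈-sym (+-assoc x y (- x))) (xyx⁻¹≈y x y)

  x-[x-y]≈y : ∀ x y → x -ᶠ (x -ᶠ y) ≈ y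
  x-[x-y]≈y x y = ≈-trans (+-congˡ (⁻¹-anti-homo‿- x y)) (x+[y-x]≈y x y)

  [x-1]*y+y≈x*y : ∀ x y → (x -ᶠ 1#) * y + y ≈ x * y
  [x-1]*y+y≈x*y x y = begin-equality
    (x -ᶠ 1#) * y + y        ≈⟨ +-congˡ (≈-sym (*-identityˡ y)) ⟩
    (x -ᶠ 1#) * y + 1# * y   ≈⟨ ≈-sym (distribʳ y (x -ᶠ 1#) 1#) ⟩
    ((x -ᶠ 1#) + 1#) * y     ≈⟨ *-congʳ (x-y+y≈x x 1#) ⟩
    x * y                    ∎

  +-cancelʳ-≤ : ∀ z {x y} → x + z ≤ y + z → x ≤ y
  +-cancelʳ-≤ z {x} {y} x+z≤y+z = begin
    x            ≈⟨ ≈-sym (x+y-y≈x x z) ⟩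
    (x + z) -ᶠ z ≤⟨ +-mono-≤ (- z) x+z≤y+z ⟩
    (y + z) -ᶠ z ≈⟨ x+y-y≈x y z ⟩
    y            ∎

  x≤y⇒0≤y-x : ∀ {x y} → x ≤ y → 0# ≤ y -ᶠ x
  x≤y⇒0≤y-x {x} {y} x≤y = begin
    0#      ≈⟨ ≈-sym (-‿inverseʳ x) ⟩
    x -ᶠ x  ≤⟨ +-mono-≤ (- x) x≤y ⟩
    y -ᶠ x  ∎

  x≤y-z⇒z+x≤y : ∀ {x y z} → x ≤ y -ᶠ z → z + x ≤ y
  x≤y-z⇒z+x≤y {x} {y} {z} x≤y-z = ≤-trans (+-monoʳ-≤ z x≤y-z) (≤-reflexive (x+[y-x]≈y z y))

  0≤y-x⇒x≤y : ∀ {x y} → 0# ≤ y -ᶠ x → x ≤ y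
  0≤y-x⇒x≤y {x} 0≤y-x = ≤-trans (≤-reflexive (≈-sym (+-identityʳ x))) (x≤y-z⇒z+x≤y 0≤y-x)

  x≤0⇒0≤-x : ∀ {x} → x ≤ 0# → 0# ≤ - x
  x≤0⇒0≤-x {x} x≤0 = ≤-trans (x≤y⇒0≤y-x x≤0) (≤-reflexive (+-identityˡ (- x)))

  *-monoˡ-≤-nonNeg : ∀ {z} → 0# ≤ z → ∀ {x y} → x ≤ y → x * z ≤ y * z
  *-monoˡ-≤-nonNeg {z} 0≤z {x} {y} x≤y = 0≤y-x⇒x≤y (begin
    0#                ≤⟨ *-nonneg (x≤y⇒0≤y-x x≤y) 0≤z ⟩
    (y -ᶠ x) * z      ≈⟨ distribʳ z y (- x) ⟩
    y * z + - x * z   ≈⟨ +-congˡ (≈-sym (-‿distribˡ-* x z)) ⟩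
    (y * z) -ᶠ (x * z) ∎)

  *-mono-≤-nonNeg : ∀ {x y u v} → 0# ≤ u → 0# ≤ y → x ≤ y → u ≤ v → x * u ≤ y * v
  *-mono-≤-nonNeg {x} {y} {u} {v} 0≤u 0≤y x≤y u≤v = begin
    x * u  ≤⟨ *-monoˡ-≤-nonNeg 0≤u x≤y ⟩
    y * u  ≈⟨ *-comm y u ⟩
    u * y  ≤⟨ *-monoˡ-≤-nonNeg 0≤y u≤v ⟩
    v * y  ≈⟨ *-comm v y ⟩
    y * v  ∎

  0≤1 : 0# ≤ 1#
  0≤1 with total 0# 1#
  ... | inj₁ 0≤1 = 0≤1
  ... | inj₂ 1≤0 = begin
    0#            ≤⟨ *-nonneg 0≤-1 0≤-1 ⟩
    - 1# * - 1#   ≈⟨ -1*x≈-x (- 1#) ⟩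
    - - 1#        ≈⟨ -‿involutive 1# ⟩
    1#            ∎
    where
    0≤-1 : 0# ≤ - 1#
    0≤-1 = x≤0⇒0≤-x 1≤0

  0≤fromℕ : ∀ k → 0# ≤ fromℕ k
  0≤fromℕ zero    = ≤-refl
  0≤fromℕ (suc k) = ≤-trans (≤-reflexive (≈-sym (+-identityʳ 0#))) (+-mono₂-≤ 0≤1 (0≤fromℕ k))

  x*y*z≈x*z*y : ∀ x y z → x * y * z ≈ x * z * y
  x*y*z≈x*z*y x y z = ≈-trans (*-assoc x y z) (≈-trans (*-congˡ (*-comm y z)) (≈-sym (*-assoc x z y)))

  0≤fromℕ[1+k]-1 : ∀ k → 0# ≤ fromℕ (suc k) -ᶠ 1#
  0≤fromℕ[1+k]-1 k = ≤-trans (0≤fromℕ k)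
    (≤-reflexive (≈-trans (≈-sym (x+y-y≈x (fromℕ k) 1#)) (+-congʳ (+-comm (fromℕ k) 1#))))

  1≤x⇒x≉0 : ∀ {x} → 1# ≤ x → ¬ (x ≈ 0#)
  1≤x⇒x≉0 1≤x x≈0 = 0≉1 (antisym 0≤1 (≤-trans 1≤x (≤-reflexive x≈0)))

  0≤x⁻¹ : ∀ {x} → 0# ≤ x → ¬ (x ≈ 0#) → 0# ≤ x ⁻¹
  0≤x⁻¹ {x} 0≤x x≉0 with total 0# (x ⁻¹)
  ... | inj₁ 0≤x⁻¹ = 0≤x⁻¹
  ... | inj₂ x⁻¹≤0 = contradiction (antisym 0≤1 (0≤y-x⇒x≤y 0≤0-1)) 0≉1
    where
    0≤0-1 : 0# ≤ 0# -ᶠ 1#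
    0≤0-1 = begin
      0#            ≤⟨ *-nonneg 0≤x (x≤0⇒0≤-x x⁻¹≤0) ⟩
      x * - x ⁻¹    ≈⟨ ≈-sym (-‿distribʳ-* x (x ⁻¹)) ⟩
      - (x * x ⁻¹)  ≈⟨ -‿cong (⁻¹-inverse x x≉0) ⟩
      - 1#          ≈⟨ ≈-sym (+-identityˡ (- 1#)) ⟩
      0# -ᶠ 1#      ∎

  x*y≤z⇒x≤z/y : ∀ {x y z} → 0# ≤ y → ¬ (y ≈ 0#) → x * y ≤ z → x ≤ z / y
  x*y≤z⇒x≤z/y {x} {y} {z} 0≤y y≉0 x*y≤z = begin
    x                ≈⟨ ≈-sym (*-identityʳ x) ⟩
    x * 1#           ≈⟨ *-congˡ (≈-sym (⁻¹-inverse y y≉0)) ⟩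
    x * (y * y ⁻¹)   ≈⟨ ≈-sym (*-assoc x y (y ⁻¹)) ⟩
    x * y * y ⁻¹     ≤⟨ *-monoˡ-≤-nonNeg (0≤x⁻¹ 0≤y y≉0) x*y≤z ⟩
    z / y            ∎

module _ {c ℓ} (F : OrderedField c ℓ) where
  open OrderedField F
  open WithField F
  open OrderedFieldProperties F

  max-operator : MaxOperator totalPreorder
  max-operator = record { _⊔_ = max ; x≤y⇒x⊔y≈y = x≤y⇒max≈y ; x≥y⇒x⊔y≈x = y≤x⇒max≈x }
    where
    x≤y⇒max≈y : ∀ {x y} → x ≤ y → max x y ≈ y
    x≤y⇒max≈y {x} {y} x≤y with x ≤? y
    ... | yes _   = ≈-refl
    ... | no  x≰y = contradiction x≤y x≰y
    y≤x⇒max≈x : ∀ {x y} → y ≤ x → max x y ≈ x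
    y≤x⇒max≈x {x} {y} y≤x with x ≤? y
    ... | yes x≤y = antisym y≤x x≤y
    ... | no  _   = ≈-refl

  min-operator : MinOperator totalPreorder
  min-operator = record { _⊓_ = min ; x≤y⇒x⊓y≈x = x≤y⇒min≈x ; x≥y⇒x⊓y≈y = y≤x⇒min≈y }
    where
    x≤y⇒min≈x : ∀ {x y} → x ≤ y → min x y ≈ x
    x≤y⇒min≈x {x} {y} x≤y with x ≤? y
    ... | yes _   = ≈-refl
    ... | no  x≰y = contradiction x≤y x≰y
    y≤x⇒min≈y : ∀ {x y} → y ≤ x → min x y ≈ y
    y≤x⇒min≈y {x} {y} y≤x with x ≤? y
    ... | yes x≤y = antisym x≤y y≤x
    ... | no  _   = ≈-refl

  open MaxOp max-operator using (⊔-lub; ⊔-mono-≤; x≤y⇒x≤y⊔z; x≤y⇒x≤z⊔y)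
  open MinOp min-operator using (⊓-glb; x≤y⇒x⊓z≤y; x≤y⇒z⊓x≤y)

  -- Finite maxima, minima and sums

  maxL-upperBound : ∀ d {x xs} → x ∈ˡ xs → x ≤ maxL d xs
  maxL-upperBound d {x} {y ∷ ys} x∈xs = foldr-preservesᵒ {P = x ≤_}
    (λ a b → [ x≤y⇒x≤y⊔z b , x≤y⇒x≤z⊔y a ]′) y ys (∈-∷⇒⊎Any ≤-refl x∈xs)

  maxL-least : ∀ d {z xs} → d ≤ z → All (_≤ z) xs → maxL d xs ≤ z
  maxL-least d d≤z []           = d≤z
  maxL-least d d≤z (x≤z ∷ xs≤z) = foldr-preservesᵇ ⊔-lub x≤z xs≤z

  maxL-greatest : ∀ d {z xs} → z ≤ d → All (z ≤_) xs → z ≤ maxL d xs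
  maxL-greatest d z≤d []          = z≤d
  maxL-greatest d {xs = x ∷ xs} z≤d (z≤x ∷ _) = ≤-trans z≤x (maxL-upperBound d {x} {x ∷ xs} (here refl))

  maxL-map-mono : ∀ {a} {A : Set a} d {f h : A → Carrier} → (∀ x → f x ≤ h x) →
                  ∀ xs → maxL d (map f xs) ≤ maxL d (map h xs)
  maxL-map-mono d f≤h []       = ≤-refl
  maxL-map-mono d {f} {h} f≤h (x ∷ xs) = foldr-mono (f≤h x) xs
    where
    foldr-mono : ∀ {u v} → u ≤ v → ∀ ys → foldr max u (map f ys) ≤ foldr max v (map h ys)
    foldr-mono u≤v []       = u≤v
    foldr-mono u≤v (y ∷ ys) = ⊔-mono-≤ (f≤h y) (foldr-mono u≤v ys)

  minL-lowerBound : ∀ d {x xs} → x ∈ˡ xs → minL d xs ≤ x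
  minL-lowerBound d {x} {y ∷ ys} x∈xs = foldr-preservesᵒ {P = _≤ x}
    (λ a b → [ x≤y⇒x⊓z≤y b , x≤y⇒z⊓x≤y a ]′) y ys (∈-∷⇒⊎Any ≤-refl x∈xs)

  minL-greatest : ∀ d {z xs} → z ≤ d → All (z ≤_) xs → z ≤ minL d xs
  minL-greatest d z≤d []           = z≤d
  minL-greatest d z≤d (z≤x ∷ z≤xs) = foldr-preservesᵇ ⊓-glb z≤x z≤xs

  ∑ : ∀ {n} → Subset n → (Fin n → Carrier) → Carrier
  ∑ []            f = 0#
  ∑ (inside  ∷ S) f = f zero + ∑ S (f ∘ suc)
  ∑ (outside ∷ S) f = ∑ S (f ∘ suc)

  sumOver-suc : ∀ {n} b (S : Subset n) f →
    foldr (λ i rest → (if does (i ∈? b ∷ S) then f i else 0#) + rest) 0# (List.tabulate suc)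
      ≡ sumOver S (f ∘ suc)
  sumOver-suc {n} b S f = ≡.trans (≡.cong (foldr step 0#) (≡.sym (map-tabulate id suc)))
                               (foldr-map step suc 0# (allFin n))
    where
    step : Fin (suc n) → Carrier → Carrier
    step i rest = (if does (i ∈? b ∷ S) then f i else 0#) + rest

  sumOver≈∑ : ∀ {n} (S : Subset n) f → sumOver S f ≈ ∑ S f
  sumOver≈∑ []          f = ≈-refl
  sumOver≈∑ (inside ∷ S) f = +-congˡ (≈-trans (≈-reflexive (sumOver-suc inside S f)) (sumOver≈∑ S (f ∘ suc)))
  sumOver≈∑ (outside ∷ S) f =
    ≈-trans (+-identityˡ _) (≈-trans (≈-reflexive (sumOver-suc outside S f)) (sumOver≈∑ S (f ∘ suc)))

  ∑-⊥ : ∀ {n} f → ∑ (⊥ {n}) f ≈ 0#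
  ∑-⊥ {zero}  f = ≈-refl
  ∑-⊥ {suc n} f = ∑-⊥ (f ∘ suc)

  ∑-mono-≤ : ∀ {n} (S : Subset n) {f h} → (∀ {i} → i ∈ S → f i ≤ h i) → ∑ S f ≤ ∑ S h
  ∑-mono-≤ []            f≤h = ≤-refl
  ∑-mono-≤ (inside  ∷ S) f≤h = +-mono₂-≤ (f≤h here) (∑-mono-≤ S (f≤h ∘ there))
  ∑-mono-≤ (outside ∷ S) f≤h = ∑-mono-≤ S (f≤h ∘ there)

  ∑-distrib-+ : ∀ {n} (S : Subset n) f h → ∑ S (λ i → f i + h i) ≈ ∑ S f + ∑ S h
  ∑-distrib-+ []            f h = ≈-sym (+-identityʳ 0#)
  ∑-distrib-+ (inside  ∷ S) f h = ≈-trans (+-congˡ (∑-distrib-+ S (f ∘ suc) (h ∘ suc)))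
    (solve 4 (λ a b x y → (a ⊕ b ⊕ (x ⊕ y)) ⊜ (a ⊕ x ⊕ (b ⊕ y))) ≈-refl (f zero) (h zero) _ _)
  ∑-distrib-+ (outside ∷ S) f h = ∑-distrib-+ S (f ∘ suc) (h ∘ suc)

  *-distribˡ-∑ : ∀ {n} (S : Subset n) x f → x * ∑ S f ≈ ∑ S (λ i → x * f i)
  *-distribˡ-∑ []            x f = zeroʳ x
  *-distribˡ-∑ (inside  ∷ S) x f = ≈-trans (distribˡ x (f zero) _) (+-congˡ (*-distribˡ-∑ S x (f ∘ suc)))
  *-distribˡ-∑ (outside ∷ S) x f = *-distribˡ-∑ S x (f ∘ suc)

  ∑-const : ∀ {n} (S : Subset n) x → ∑ S (λ _ → x) ≈ fromℕ ∣ S ∣ * x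
  ∑-const []            x = ≈-sym (zeroˡ x)
  ∑-const (inside  ∷ S) x = ≈-trans (+-congˡ (∑-const S x))
    (≈-sym (≈-trans (distribʳ x 1# (fromℕ ∣ S ∣)) (+-congʳ (*-identityˡ x))))
  ∑-const (outside ∷ S) x = ∑-const S x

  ∑-remove : ∀ {n} (S : Subset n) f {i} → i ∈ S → ∑ S f ≈ f i + ∑ (S - i) f
  ∑-remove (inside ∷ S) f here =
    +-congˡ (≈-reflexive (≡.cong (λ T → ∑ T (f ∘ suc)) (≡.sym (zipWith-identityʳ (λ _ → refl) S))))
  ∑-remove (inside ∷ S) f {suc i} (there i∈S) = ≈-trans (+-congˡ (∑-remove S (f ∘ suc) i∈S))
    (solve 3 (λ a b x → (a ⊕ (b ⊕ x)) ⊜ (b ⊕ (a ⊕ x))) ≈-refl (f zero) (f (suc i)) _)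
  ∑-remove (outside ∷ S) f (there i∈S) = ∑-remove S (f ∘ suc) i∈S

  ∑-averaging : ∀ {n} (S : Subset n) f c G → (∀ {j} → j ∈ S → f j + c * ∑ (S - j) f ≤ G) →
                ∑ S f * (1# + (fromℕ ∣ S ∣ -ᶠ 1#) * c) ≤ fromℕ ∣ S ∣ * G
  ∑-averaging S f c G bound = +-cancelʳ-≤ (c * Σ) (begin
    Σ * (1# + (s -ᶠ 1#) * c) + c * Σ    ≈⟨ +-congʳ (≈-trans (distribˡ Σ 1# _) (+-congʳ (*-identityʳ Σ))) ⟩
    Σ + Σ * ((s -ᶠ 1#) * c) + c * Σ     ≈⟨ solve 3 (λ Σ t c → (Σ ⊕ Σ ⊗ (t ⊗ c) ⊕ c ⊗ Σ)
                                                          ⊜ (Σ ⊕ (t ⊗ (c ⊗ Σ) ⊕ c ⊗ Σ)))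
                                             ≈-refl Σ (s -ᶠ 1#) c ⟩
    Σ + ((s -ᶠ 1#) * (c * Σ) + c * Σ)   ≈⟨ +-congˡ ([x-1]*y+y≈x*y s (c * Σ)) ⟩
    Σ + s * (c * Σ)                    ≈⟨ +-congˡ (≈-sym (∑-const S (c * Σ))) ⟩
    Σ + ∑ S (λ _ → c * Σ)              ≈⟨ ≈-sym (∑-distrib-+ S f (λ _ → c * Σ)) ⟩
    ∑ S (λ j → f j + c * Σ)            ≤⟨ ∑-mono-≤ S pointwise ⟩
    ∑ S (λ j → G + c * f j)            ≈⟨ ∑-distrib-+ S (λ _ → G) (λ j → c * f j) ⟩
    ∑ S (λ _ → G) + ∑ S (λ j → c * f j) ≈⟨ +-cong (∑-const S G) (≈-sym (*-distribˡ-∑ S c f)) ⟩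
    s * G + c * Σ                      ∎)
    where
    Σ = ∑ S f
    s = fromℕ ∣ S ∣
    pointwise : ∀ {j} → j ∈ S → f j + c * Σ ≤ G + c * f j
    pointwise {j} j∈S = begin
      f j + c * Σ                          ≈⟨ +-congˡ (*-congˡ (∑-remove S f j∈S)) ⟩
      f j + c * (f j + ∑ (S - j) f)        ≈⟨ solve 4 (λ a c b r → (a ⊕ c ⊗ (b ⊕ r)) ⊜ (a ⊕ c ⊗ r ⊕ c ⊗ b))
                                                    ≈-refl (f j) c (f j) (∑ (S - j) f) ⟩
      f j + c * ∑ (S - j) f + c * f j      ≤⟨ +-mono-≤ (c * f j) (bound j∈S) ⟩
      G + c * f j                          ∎

  -- Subadditive set functions

  singletonSum : ∀ {n} → SetFun n → Subset n → Carrier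
  singletonSum g S = ∑ S (λ i → g ⁅ i ⁆)

  g≤singletonSum : ∀ {n} {g : SetFun n} → Normalized g → Nondecreasing g → Subadditive g →
                   ∀ T → g T ≤ singletonSum g T
  g≤singletonSum {g = g} norm mono sub = remove-induction (λ T → g T ≤ singletonSum g T)
    (≤-reflexive (≈-trans norm (≈-sym (∑-⊥ (λ i → g ⁅ i ⁆)))))
    λ T {k} k∈T IH → begin
      g T                          ≤⟨ mono T _ (p⊆⁅x⁆∪[p-x] T k) ⟩
      g (⁅ k ⁆ ∪ (T - k))          ≤⟨ sub ⁅ k ⁆ (T - k) ⟩
      g ⁅ k ⁆ + g (T - k)          ≤⟨ +-monoʳ-≤ (g ⁅ k ⁆) IH ⟩
      g ⁅ k ⁆ + singletonSum g (T - k) ≈⟨ ≈-sym (∑-remove T _ k∈T) ⟩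
      singletonSum g T             ∎

  MarginalLowerBound : ∀ {n} → SetFun n → Subset n → Carrier → Set ℓ
  MarginalLowerBound g S c = ∀ {A i} → A ⊆ S → i ∈ A → g (A - i) + c * g ⁅ i ⁆ ≤ g ((A - i) ∪ ⁅ i ⁆)

  g[B]+c*singletonSum[T]≤g[B∪T] : ∀ {n} {g : SetFun n} {S c} →
                                  Nondecreasing g → MarginalLowerBound g S c →
                                  ∀ T {B} → B ∪ T ⊆ S → (∀ {k} → k ∈ T → k ∉ B) →
                                  g B + c * singletonSum g T ≤ g (B ∪ T)
  g[B]+c*singletonSum[T]≤g[B∪T] {g = g} {S} {c} mono marginal = remove-induction P base step
    where
    P : Subset _ → Set _
    P T = ∀ {B} → B ∪ T ⊆ S → (∀ {k} → k ∈ T → k ∉ B) → g B + c * singletonSum g T ≤ g (B ∪ T)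

    base : P ⊥
    base {B} _ _ = ≤-reflexive (begin-equality
      g B + c * singletonSum g ⊥  ≈⟨ +-congˡ (≈-trans (*-congˡ (∑-⊥ (λ i → g ⁅ i ⁆))) (zeroʳ c)) ⟩
      g B + 0#                    ≈⟨ +-identityʳ (g B) ⟩
      g B                         ≡⟨ ≡.cong g (≡.sym (∪-identityʳ B)) ⟩
      g (B ∪ ⊥)                   ∎)

    step : ∀ T {k} → k ∈ T → P (T - k) → P T
    step T {k} k∈T IH {B} B∪T⊆S T∩B=∅ = begin
      g B + c * singletonSum g T                    ≈⟨ +-congˡ (*-congˡ (∑-remove T _ k∈T)) ⟩
      g B + c * (g ⁅ k ⁆ + singletonSum g (T - k))  ≈⟨ solve 4 (λ b c x r → (b ⊕ c ⊗ (x ⊕ r))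
                                                                        ⊜ (b ⊕ c ⊗ r ⊕ c ⊗ x))
                                                          ≈-refl (g B) c (g ⁅ k ⁆) _ ⟩
      g B + c * singletonSum g (T - k) + c * g ⁅ k ⁆ ≤⟨ +-mono-≤ _ (IH (B∪T⊆S ∘ B∪[T-k]⊆B∪T) T-k∩B=∅) ⟩
      g (B ∪ (T - k)) + c * g ⁅ k ⁆                 ≤⟨ +-mono-≤ _ (mono _ _ (p∪[q-x]⊆[p∪q]-x B T (T∩B=∅ k∈T))) ⟩
      g ((B ∪ T) - k) + c * g ⁅ k ⁆                 ≤⟨ marginal B∪T⊆S (q⊆p∪q B T k∈T) ⟩
      g (((B ∪ T) - k) ∪ ⁅ k ⁆)                     ≤⟨ mono _ _ ([p-x]∪⁅x⁆⊆p (q⊆p∪q B T k∈T)) ⟩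
      g (B ∪ T)                                     ∎
      where
      B∪[T-k]⊆B∪T : B ∪ (T - k) ⊆ B ∪ T
      B∪[T-k]⊆B∪T = ∪-monoʳ-⊆ B (p─q⊆p T ⁅ k ⁆)
      T-k∩B=∅ : ∀ {i} → i ∈ T - k → i ∉ B
      T-k∩B=∅ = T∩B=∅ ∘ p─q⊆p T ⁅ k ⁆

  -- Curvature

  minMarginalRatio : ∀ {n} → SetFun n → Subset n → Carrier
  minMarginalRatio g S = minL 1# (curvRatios g S)

  1-curvature≈minMarginalRatio : ∀ {n} (g : SetFun n) S → 1# -ᶠ curvature g S ≈ minMarginalRatio g S
  1-curvature≈minMarginalRatio g S = x-[x-y]≈y 1# (minMarginalRatio g S)

  marginalRatio : ∀ {n} → SetFun n → Subset n → Fin n → Carrier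
  marginalRatio g A i = marginal g i (A - i) / g ⁅ i ⁆

  module _ {n} (g : SetFun n) (S : Subset n) where

    marginalRatio∈curvRatios : ∀ {A i} → A ⊆ S → i ∈ A → marginalRatio g A i ∈ˡ curvRatios g S
    marginalRatio∈curvRatios {A} {i} A⊆S i∈A =
      ∈-concatMap⁺ (λ A → if does (A ⊆? S) then ratiosOf A else [])
        (lose (∈-allSubsets A) (∈-if-true (dec-true (A ⊆? S) A⊆S)
          (∈-concatMap⁺ (λ i → if does (i ∈? A) then marginalRatio g A i ∷ [] else [])
            (lose (∈-allFin i) (∈-if-true (dec-true (i ∈? A) i∈A) (here refl))))))
      where
      ratiosOf : Subset n → List Carrier
      ratiosOf A = concatMap (λ i → if does (i ∈? A) then marginalRatio g A i ∷ [] else []) (allFin n)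

    All-curvRatios : ∀ {P : Carrier → Set ℓ} → (∀ A i → P (marginalRatio g A i)) → All P (curvRatios g S)
    All-curvRatios P-ratio = concat⁺ (All-map (λ A → All-if (does (A ⊆? S))
      (concat⁺ (All-map (λ i → All-if (does (i ∈? A)) (P-ratio A i ∷ [])) (allFin n)))) (allSubsets n))

  module _ {n} {g : SetFun n} (mono : Nondecreasing g) (pos : PositiveSingletons g) (S : Subset n) where

    private
      g⁅i⁆≉0 : ∀ i → ¬ (g ⁅ i ⁆ ≈ 0#)
      g⁅i⁆≉0 i = proj₂ (pos i) ∘ ≈-sym

    0≤minMarginalRatio : 0# ≤ minMarginalRatio g S
    0≤minMarginalRatio = minL-greatest 1# 0≤1 (All-curvRatios g S λ A i →
      *-nonneg (x≤y⇒0≤y-x (mono _ _ (p⊆p∪q ⁅ i ⁆))) (0≤x⁻¹ (proj₁ (pos i)) (g⁅i⁆≉0 i)))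

    minMarginalRatio-marginalLowerBound : MarginalLowerBound g S (minMarginalRatio g S)
    minMarginalRatio-marginalLowerBound {A} {i} A⊆S i∈A = x≤y-z⇒z+x≤y (begin
      minMarginalRatio g S * g ⁅ i ⁆   ≤⟨ *-monoˡ-≤-nonNeg (proj₁ (pos i))
                                             (minL-lowerBound 1# (marginalRatio∈curvRatios g S A⊆S i∈A)) ⟩
      m / g ⁅ i ⁆ * g ⁅ i ⁆           ≈⟨ *-assoc m _ _ ⟩
      m * (g ⁅ i ⁆ ⁻¹ * g ⁅ i ⁆)      ≈⟨ *-congˡ (≈-trans (*-comm _ _) (⁻¹-inverse _ (g⁅i⁆≉0 i))) ⟩
      m * 1#                          ≈⟨ *-identityʳ m ⟩
      m                               ∎)
      where
      m = marginal g i (A - i)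

    g⁅j⁆+minMarginalRatio*singletonSum[S-j]≤g[S] : ∀ {j} → j ∈ S →
                                  g ⁅ j ⁆ + minMarginalRatio g S * singletonSum g (S - j) ≤ g S
    g⁅j⁆+minMarginalRatio*singletonSum[S-j]≤g[S] {j} j∈S = ≤-trans
      (g[B]+c*singletonSum[T]≤g[B∪T] mono minMarginalRatio-marginalLowerBound (S - j) ⁅j⁆∪[S-j]⊆S
        (λ k∈S-j k∈⁅j⁆ → x∈p-y⇒x≢y S k∈S-j (x∈⁅y⁆⇒x≡y j k∈⁅j⁆)))
      (mono _ _ ⁅j⁆∪[S-j]⊆S)
      where
      ⁅j⁆∪[S-j]⊆S : ⁅ j ⁆ ∪ (S - j) ⊆ S
      ⁅j⁆∪[S-j]⊆S = ∪-least (x∈p⇒⁅x⁆⊆p j∈S) (p─q⊆p S ⁅ j ⁆)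

    private
      D : Carrier
      D = 1# + (fromℕ ∣ S ∣ -ᶠ 1#) * (1# -ᶠ curvature g S)

      1≤D : ∀ {k} → ∣ S ∣ ≡ suc k → 1# ≤ D
      1≤D {k} |S|≡1+k = ≤-trans (≤-reflexive (≈-sym (+-identityʳ 1#))) (+-monoʳ-≤ 1# (*-nonneg
        (≡.subst (λ s → 0# ≤ fromℕ s -ᶠ 1#) (≡.sym |S|≡1+k) (0≤fromℕ[1+k]-1 k))
        (≤-trans 0≤minMarginalRatio (≤-reflexive (≈-sym (1-curvature≈minMarginalRatio g S))))))

    0≤approxFactor : 0# ≤ approxFactor g S
    0≤approxFactor with ∣ S ∣ in |S|≡
    ... | zero  = ≤-refl
    ... | suc k = *-nonneg (0≤fromℕ ∣ S ∣) (0≤x⁻¹ (≤-trans 0≤1 (1≤D |S|≡)) (1≤x⇒x≉0 (1≤D |S|≡)))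

    singletonSum≤approxFactor*g : singletonSum g S ≤ approxFactor g S * g S
    singletonSum≤approxFactor*g with ∣ S ∣ in |S|≡
    ... | zero = ≤-reflexive (begin-equality
      singletonSum g S   ≡⟨ ≡.cong (singletonSum g) (∣p∣≡0⇒p≡⊥ {p = S} |S|≡) ⟩
      singletonSum g ⊥   ≈⟨ ∑-⊥ (λ i → g ⁅ i ⁆) ⟩
      0#                 ≈⟨ ≈-sym (zeroˡ (g S)) ⟩
      0# * g S           ∎)
    ... | suc k = begin
      Σ                   ≤⟨ x*y≤z⇒x≤z/y (≤-trans 0≤1 (1≤D |S|≡)) (1≤x⇒x≉0 (1≤D |S|≡)) Σ*D≤s*gS ⟩
      (s * g S) / D       ≈⟨ x*y*z≈x*z*y s (g S) (D ⁻¹) ⟩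
      s / D * g S         ∎
      where
      Σ = singletonSum g S
      s = fromℕ ∣ S ∣
      Σ*D≤s*gS : Σ * D ≤ s * g S
      Σ*D≤s*gS = begin
        Σ * D                                         ≈⟨ *-congˡ (+-congˡ (*-congˡ
                                                           (1-curvature≈minMarginalRatio g S))) ⟩
        Σ * (1# + (s -ᶠ 1#) * minMarginalRatio g S)  ≤⟨ ∑-averaging S (λ i → g ⁅ i ⁆) (minMarginalRatio g S) (g S)
                                                           g⁅j⁆+minMarginalRatio*singletonSum[S-j]≤g[S] ⟩
        s * g S                                       ∎

  -- Partitions

  module _ {n m} {g : Fin m → SetFun n} where

    costMax≤costModular : (∀ j → Normalized (g j)) → (∀ j → Nondecreasing (g j)) →
                          (∀ j → Subadditive (g j)) → ∀ σ → costMax g σ ≤ costModular g σ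
    costMax≤costModular norm mono sub σ = maxL-map-mono 0# bound (allFin m)
      where
      bound : ∀ j → g j (block σ j) ≤ sumOver (block σ j) (λ i → g j ⁅ i ⁆)
      bound j = ≤-trans (g≤singletonSum (norm j) (mono j) (sub j) (block σ j))
                        (≤-reflexive (≈-sym (sumOver≈∑ (block σ j) _)))

    costModular≤factorMax*costMax : (∀ j → Nonnegative (g j)) → (∀ j → Nondecreasing (g j)) →
                                    (∀ j → PositiveSingletons (g j)) →
                                    ∀ σ → costModular g σ ≤ factorMax g σ * costMax g σ
    costModular≤factorMax*costMax nonneg mono pos σ =
      maxL-least 0# (*-nonneg 0≤factorMax 0≤costMax) (All-map bound (allFin m))
      where
      0≤factorMax : 0# ≤ factorMax g σ
      0≤factorMax = maxL-greatest 0# ≤-refl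
        (All-map (λ j → 0≤approxFactor (mono j) (pos j) (block σ j)) (allFin m))
      0≤costMax : 0# ≤ costMax g σ
      0≤costMax = maxL-greatest 0# ≤-refl (All-map (λ j → nonneg j (block σ j)) (allFin m))
      bound : ∀ j → sumOver (block σ j) (λ i → g j ⁅ i ⁆) ≤ factorMax g σ * costMax g σ
      bound j = begin
        sumOver S (λ i → g j ⁅ i ⁆)   ≈⟨ sumOver≈∑ S _ ⟩
        singletonSum (g j) S          ≤⟨ singletonSum≤approxFactor*g (mono j) (pos j) S ⟩
        approxFactor (g j) S * g j S  ≤⟨ *-mono-≤-nonNeg (nonneg j S) 0≤factorMax
                                           (maxL-upperBound 0# (∈-map⁺ _ (∈-allFin j)))
                                           (maxL-upperBound 0# (∈-map⁺ _ (∈-allFin j))) ⟩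
        factorMax g σ * costMax g σ   ∎
        where
        S = block σ j

lemma8 : ∀ {c ℓ} (F : OrderedField c ℓ) (n m : ℕ)
           (g : Fin m → WithField.SetFun F n) →
           (∀ j → WithField.Normalized F (g j)) →
           (∀ j → WithField.Nonnegative F (g j)) →
           (∀ j → WithField.Nondecreasing F (g j)) →
           (∀ j → WithField.Subadditive F (g j)) →
           (∀ j → WithField.PositiveSingletons F (g j)) →
           (S0 Sstar : Partition n m) →
           (∀ σ → OrderedField._≤_ F (WithField.costModular F g S0) (WithField.costModular F g σ)) →
           (∀ σ → OrderedField._≤_ F (WithField.costMax F g Sstar) (WithField.costMax F g σ)) →
           OrderedField._≤_ F (WithField.costMax F g S0)
             (OrderedField._*_ F (WithField.factorMax F g Sstar) (WithField.costMax F g Sstar))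
lemma8 F n m g norm nonneg mono sub pos S0 Sstar S0-optimal _ = begin
  costMax g S0                         ≤⟨ costMax≤costModular F norm mono sub S0 ⟩
  costModular g S0                     ≤⟨ S0-optimal Sstar ⟩
  costModular g Sstar                  ≤⟨ costModular≤factorMax*costMax F nonneg mono pos Sstar ⟩
  factorMax g Sstar * costMax g Sstar  ∎
  where
  open OrderedField F
  open WithField F
  open OrderedFieldProperties F
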